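{- Let $G$ be a signed cycle on $n\geq 3$ vertices, and let $e^-$ be the number of negative edges of $G$. Then the determinant of any oriented net incidence matrix of $G$ is $0$, and the determinant of the net incidence matrix of $G$ is $\pm 2\,\mathrm{i}^{e^- }$ if $n$ is odd and $0$ if $n$ is even.
   Context: A signed graph is a simple graph together with a sign in $\{1,-1\}$ on each edge (positive if $1$, negative if $-1$). For a signed graph with vertices $1,\ldots,n$ and edges $e_1,\ldots,e_m$, the net incidence matrix $M^{\pm}=[m_{i\ell}]$ is the $n\times m$ matrix whose column $\ell$, for $e_\ell=\{i,j\}$, has exactly two nonzero entries $m_{i\ell}=m_{j\ell}$, equal to $1$ if $e_\ell$ is positive and to the imaginary unit $\mathrm{i}$ if negative. An oriented net incidence matrix is obtained from $M^{\pm}$ by multiplying exactly one of the two nonzero entries of each column by $-1$. For a cycle these are $n\times n$ matrices. "$\pm$" means the value holds for one of the two signs. -}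

module Defs where

open import Data.Nat as ℕ using (ℕ; zero; suc; _%_)
open import Data.Nat.DivMod using (m%n<n)
open import Data.Integer as ℤ using (ℤ; +_)
open import Data.Fin using (Fin; zero; suc; toℕ; fromℕ<; punchIn; _≟_)
open import Data.Fin.Permutation using (Permutation′; _⟨$⟩ʳ_)
open import Data.Bool using (Bool; true; false; if_then_else_; _∨_)
open import Relation.Nullary using (does)

-- Gaussian integers ℤ[i] (the entries of (oriented) net incidence
-- matrices lie in ℤ[i] ⊂ ℂ).

record ℤi : Set where
  constructor _+_i
  field
    re : ℤ
    im : ℤ
open ℤi public

0ℤi 1ℤi iℤi : ℤi
0ℤi = (+ 0) + (+ 0) i
1ℤi = (+ 1) + (+ 0) i
iℤi = (+ 0) + (+ 1) i

_+ᵢ_ : ℤi → ℤi → ℤi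
(a + b i) +ᵢ (c + d i) = (a ℤ.+ c) + (b ℤ.+ d) i

_*ᵢ_ : ℤi → ℤi → ℤi
(a + b i) *ᵢ (c + d i) = (a ℤ.* c ℤ.- b ℤ.* d) + (a ℤ.* d ℤ.+ b ℤ.* c) i

-ᵢ_ : ℤi → ℤi
-ᵢ (a + b i) = (ℤ.- a) + (ℤ.- b) i

_^ᵢ_ : ℤi → ℕ → ℤi
z ^ᵢ zero  = 1ℤi
z ^ᵢ suc k = z *ᵢ (z ^ᵢ k)

-- Square matrices and the determinant (Laplace expansion along the
-- first row, which agrees with the Leibniz formula).

Matrix : ℕ → Set
Matrix n = Fin n → Fin n → ℤi

sumFin : ∀ {n} → (Fin n → ℤi) → ℤi
sumFin {zero}  f = 0ℤi
sumFin {suc n} f = f zero +ᵢ sumFin (λ j → f (suc j))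

signPow : ℕ → ℤi
signPow zero          = 1ℤi
signPow (suc zero)    = -ᵢ 1ℤi
signPow (suc (suc k)) = signPow k

minor : ∀ {n} → Matrix (suc n) → Fin (suc n) → Matrix n
minor M j r c = M (suc r) (punchIn j c)

det : ∀ {n} → Matrix n → ℤi
det {zero}  M = 1ℤi
det {suc n} M = sumFin (λ j → (signPow (toℕ j) *ᵢ M zero j) *ᵢ det (minor M j))

data Sign : Set where
  positive negative : Sign

next : ∀ {n} → Fin n → Fin n
next {suc m} k = fromℕ< (m%n<n (suc (toℕ k)) (suc m))

countNeg : ∀ {n} → (Fin n → Sign) → ℕ
countNeg {zero}  s = zero
countNeg {suc n} s with s zero
... | positive = countNeg (λ j → s (suc j))
... | negative = suc (countNeg (λ j → s (suc j)))

-- A signed cycle on the vertex set Fin n (n ≥ 3), with edges listed as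
-- columns, is described by:
--   π : the cyclic order of the vertices; cycle edge k is {π k, π (k+1 mod n)},
--   s : the sign of cycle edge k,
--   σ : the edge ordering; column ℓ of the incidence matrix is cycle edge σ ℓ.
-- Every signed n-cycle on labelled vertices with ordered edges arises so.

endA endB : ∀ {n} → Permutation′ n → Permutation′ n → Fin n → Fin n
endA π σ ℓ = π ⟨$⟩ʳ (σ ⟨$⟩ʳ ℓ)
endB π σ ℓ = π ⟨$⟩ʳ next (σ ⟨$⟩ʳ ℓ)

signVal : Sign → ℤi
signVal positive = 1ℤi
signVal negative = iℤi

netInc : ∀ {n} → Permutation′ n → Permutation′ n → (Fin n → Sign) → Matrix n
netInc π σ s v ℓ =
  if does (v ≟ endA π σ ℓ) ∨ does (v ≟ endB π σ ℓ)
  then signVal (s (σ ⟨$⟩ʳ ℓ)) else 0ℤi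

orientedNetInc : ∀ {n} → Permutation′ n → Permutation′ n → (Fin n → Sign)
               → (Fin n → Bool) → Matrix n
orientedNetInc π σ s o v ℓ =
  if does (v ≟ endA π σ ℓ)
  then (if o ℓ then -ᵢ c else c)
  else (if does (v ≟ endB π σ ℓ) then (if o ℓ then c else -ᵢ c) else 0ℤi)
  where c = signVal (s (σ ⟨$⟩ʳ ℓ))

module Submission where

-- Number the vertices along the cycle and the edges by position, edge k joining vertices
-- k and k+1 (mod n).  In these coordinates the net incidence matrix, and any oriented one,
-- is C(a,b), the matrix with a at (k,k), b at (k+1,k) and 0 elsewhere, with its columns
-- scaled by ±1 times the edge values 1 or i: a = b = 1 for the net matrix, a = 1, b = -1
-- for an oriented one.  Relabelling vertices and edges only changes the sign of the
-- determinant.  Expanding along the first row, det C(a,b) = a^n + (-1)^(n-1) b^n, the two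
-- surviving minors being triangular with diagonals a and b.  So an oriented matrix has
-- determinant a multiple of 1 + (-1)^(n-1) (-1)^n = 0, while the net matrix has
-- determinant ±i^(e⁻) (1 + (-1)^(n-1)).

open import Defs
open import Data.Nat using (ℕ; _≤_; _%_)
open import Data.Fin using (Fin)
open import Data.Fin.Permutation using (Permutation′)
open import Data.Bool using (Bool)
open import Data.Product using (_×_)
open import Data.Sum using (_⊎_)
open import Relation.Binary.PropositionalEquality using (_≡_)

open import Level using (0ℓ)
open import Data.Nat as ℕ using (zero; suc; s≤s)
import Data.Nat.Properties as ℕ
open import Data.Nat.DivMod using (m%n<n; m<n⇒m%n≡m; n%n≡0)
open import Data.Integer as ℤ using (ℤ; +_)
import Data.Integer.Properties as ℤ
import Data.Integer.Tactic.RingSolver as ℤ-Solver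
open import Data.Fin using (zero; suc; toℕ; fromℕ; inject₁; punchIn; _<_; _≟_)
open import Data.Fin.Properties
  using (toℕ-fromℕ<; toℕ-fromℕ; toℕ-inject₁; toℕ-injective; toℕ<n; suc-injective; <⇒≢; 0≢1+n)
open import Data.Fin.Permutation using (_⟨$⟩ʳ_; _⟨$⟩ˡ_; flip; remove; punchIn-permute)
open import Data.Bool using (true; false; if_then_else_)
open import Data.Maybe using (Maybe; just; nothing)
open import Data.Product using (_,_)
open import Data.Sum as Sum using (inj₁; inj₂)
open import Function using (_∘_; Inverse; mk⇔)
open import Relation.Nullary using (does; yes)
open import Relation.Nullary.Decidable using (dec-true; dec-false; does-⇔)
open import Relation.Binary.PropositionalEquality
  using (refl; sym; trans; cong; cong₂; subst; subst₂; _≢_; isEquivalence; module ≡-Reasoning)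
open import Algebra.Bundles using (CommutativeRing)
open import Algebra.Definitions {A = ℤi} _≡_
open import Algebra.Structures {A = ℤi} _≡_ using (IsCommutativeRing)
open import Algebra.Consequences.Propositional {A = ℤi} using (comm∧idˡ⇒id; comm∧distrˡ⇒distrʳ)
open import Tactic.RingSolver.Core.AlmostCommutativeRing using (AlmostCommutativeRing; fromCommutativeRing)
open import Tactic.RingSolver using (solve-∀)
open ≡-Reasoning

-- The Gaussian integers as a commutative ring

*ᵢ-comm : Commutative _*ᵢ_
*ᵢ-comm (a + b i) (c + d i) = cong₂ _+_i (re-comm a b c d) (im-comm a b c d)
  where
  re-comm : ∀ a b c d → a ℤ.* c ℤ.- b ℤ.* d ≡ c ℤ.* a ℤ.- d ℤ.* b
  re-comm = ℤ-Solver.solve-∀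
  im-comm : ∀ a b c d → a ℤ.* d ℤ.+ b ℤ.* c ≡ c ℤ.* b ℤ.+ d ℤ.* a
  im-comm = ℤ-Solver.solve-∀

*ᵢ-assoc : Associative _*ᵢ_
*ᵢ-assoc (a + b i) (c + d i) (e + f i) = cong₂ _+_i (re-assoc a b c d e f) (im-assoc a b c d e f)
  where
  re-assoc : ∀ a b c d e f → (a ℤ.* c ℤ.- b ℤ.* d) ℤ.* e ℤ.- (a ℤ.* d ℤ.+ b ℤ.* c) ℤ.* f
                           ≡ a ℤ.* (c ℤ.* e ℤ.- d ℤ.* f) ℤ.- b ℤ.* (c ℤ.* f ℤ.+ d ℤ.* e)
  re-assoc = ℤ-Solver.solve-∀
  im-assoc : ∀ a b c d e f → (a ℤ.* c ℤ.- b ℤ.* d) ℤ.* f ℤ.+ (a ℤ.* d ℤ.+ b ℤ.* c) ℤ.* e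
                           ≡ a ℤ.* (c ℤ.* f ℤ.+ d ℤ.* e) ℤ.+ b ℤ.* (c ℤ.* e ℤ.- d ℤ.* f)
  im-assoc = ℤ-Solver.solve-∀

*ᵢ-identityˡ : LeftIdentity 1ℤi _*ᵢ_
*ᵢ-identityˡ (a + b i) = cong₂ _+_i (re-identity a b) (im-identity a b)
  where
  re-identity : ∀ a b → + 1 ℤ.* a ℤ.- + 0 ℤ.* b ≡ a
  re-identity = ℤ-Solver.solve-∀
  im-identity : ∀ a b → + 1 ℤ.* b ℤ.+ + 0 ℤ.* a ≡ b
  im-identity = ℤ-Solver.solve-∀

*ᵢ-distribˡ-+ᵢ : _*ᵢ_ DistributesOverˡ _+ᵢ_
*ᵢ-distribˡ-+ᵢ (a + b i) (c + d i) (e + f i) = cong₂ _+_i (re-distrib a b c d e f) (im-distrib a b c d e f)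
  where
  re-distrib : ∀ a b c d e f → a ℤ.* (c ℤ.+ e) ℤ.- b ℤ.* (d ℤ.+ f)
                             ≡ (a ℤ.* c ℤ.- b ℤ.* d) ℤ.+ (a ℤ.* e ℤ.- b ℤ.* f)
  re-distrib = ℤ-Solver.solve-∀
  im-distrib : ∀ a b c d e f → a ℤ.* (d ℤ.+ f) ℤ.+ b ℤ.* (c ℤ.+ e)
                             ≡ (a ℤ.* d ℤ.+ b ℤ.* c) ℤ.+ (a ℤ.* f ℤ.+ b ℤ.* e)
  im-distrib = ℤ-Solver.solve-∀

ℤi-isCommutativeRing : IsCommutativeRing _+ᵢ_ _*ᵢ_ -ᵢ_ 0ℤi 1ℤi
ℤi-isCommutativeRing = record
  { isRing = record
    { +-isAbelianGroup = record
      { isGroup = record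
        { isMonoid = record
          { isSemigroup = record
            { isMagma = record { isEquivalence = isEquivalence ; ∙-cong = cong₂ _+ᵢ_ }
            ; assoc = λ where (a + b i) (c + d i) (e + f i) → cong₂ _+_i (ℤ.+-assoc a c e) (ℤ.+-assoc b d f) }
          ; identity = (λ where (a + b i) → cong₂ _+_i (ℤ.+-identityˡ a) (ℤ.+-identityˡ b))
                     , (λ where (a + b i) → cong₂ _+_i (ℤ.+-identityʳ a) (ℤ.+-identityʳ b)) }
        ; inverse = (λ where (a + b i) → cong₂ _+_i (ℤ.+-inverseˡ a) (ℤ.+-inverseˡ b))
                  , (λ where (a + b i) → cong₂ _+_i (ℤ.+-inverseʳ a) (ℤ.+-inverseʳ b))
        ; ⁻¹-cong = cong -ᵢ_ }
      ; comm = λ where (a + b i) (c + d i) → cong₂ _+_i (ℤ.+-comm a c) (ℤ.+-comm b d) }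
    ; *-cong = cong₂ _*ᵢ_
    ; *-assoc = *ᵢ-assoc
    ; *-identity = comm∧idˡ⇒id *ᵢ-comm *ᵢ-identityˡ
    ; distrib = *ᵢ-distribˡ-+ᵢ , comm∧distrˡ⇒distrʳ *ᵢ-comm *ᵢ-distribˡ-+ᵢ
    }
  ; *-comm = *ᵢ-comm
  }

ℤi-commutativeRing : CommutativeRing 0ℓ 0ℓ
ℤi-commutativeRing = record { isCommutativeRing = ℤi-isCommutativeRing }

0≟ᵢ_ : (x : ℤi) → Maybe (0ℤi ≡ x)
0≟ᵢ (a + b i) with + 0 ℤ.≟ a | + 0 ℤ.≟ b
... | yes refl | yes refl = just refl
... | _        | _        = nothing

ℤi-ring : AlmostCommutativeRing 0ℓ 0ℓ
ℤi-ring = fromCommutativeRing ℤi-commutativeRing 0≟ᵢ_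

open CommutativeRing ℤi-commutativeRing
  using (ring; semiring; *-commutativeMonoid; zeroˡ; zeroʳ; *-identityˡ; *-identityʳ)
open import Algebra.Properties.Ring ring using (-1*x≈-x; -‿involutive; -‿distribˡ-*; -‿distribʳ-*)
open import Algebra.Properties.Semiring.Sum semiring
  using (sum; ∑-comm; sum-cong-≗; sum-replicate-zero; *-distribˡ-sum; sum-init-last)
open import Algebra.Properties.CommutativeMonoid.Sum *-commutativeMonoid
  using () renaming (sum to product; ∑-permute to product-permute)

sumFin≡sum : ∀ {n} (f : Fin n → ℤi) → sumFin f ≡ sum f
sumFin≡sum {zero}  f = refl
sumFin≡sum {suc n} f = cong (f zero +ᵢ_) (sumFin≡sum (f ∘ suc))

sum-zero : ∀ {n} {f : Fin n → ℤi} → (∀ j → f j ≡ 0ℤi) → sum f ≡ 0ℤi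
sum-zero {n} f≗0 = trans (sum-cong-≗ f≗0) (sum-replicate-zero n)

sum-neg : ∀ {n} (f : Fin n → ℤi) → sum (λ j → -ᵢ f j) ≡ -ᵢ sum f
sum-neg f = begin
  sum (λ j → -ᵢ f j)             ≡⟨ sum-cong-≗ (λ j → -1*x≈-x (f j)) ⟨
  sum (λ j → (-ᵢ 1ℤi) *ᵢ f j)    ≡⟨ *-distribˡ-sum (-ᵢ 1ℤi) f ⟨
  (-ᵢ 1ℤi) *ᵢ sum f              ≡⟨ -1*x≈-x (sum f) ⟩
  -ᵢ sum f                       ∎

product-const : ∀ {n} {f : Fin n → ℤi} {x} → (∀ k → f k ≡ x) → product f ≡ x ^ᵢ n
product-const {zero}  _   = refl
product-const {suc n} f≗x = cong₂ _*ᵢ_ (f≗x zero) (product-const (f≗x ∘ suc))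

signPow-suc : ∀ k → signPow (suc k) ≡ -ᵢ signPow k
signPow-suc zero    = refl
signPow-suc (suc k) = begin
  signPow k               ≡⟨ -‿involutive (signPow k) ⟨
  -ᵢ (-ᵢ signPow k)       ≡⟨ cong -ᵢ_ (signPow-suc k) ⟨
  -ᵢ signPow (suc k)      ∎

IsSignUnit : ℤi → Set
IsSignUnit x = x ≡ 1ℤi ⊎ x ≡ -ᵢ 1ℤi

IsSignUnit-* : ∀ {x y} → IsSignUnit x → IsSignUnit y → IsSignUnit (x *ᵢ y)
IsSignUnit-* (inj₁ refl) (inj₁ refl) = inj₁ refl
IsSignUnit-* (inj₁ refl) (inj₂ refl) = inj₂ refl
IsSignUnit-* (inj₂ refl) (inj₁ refl) = inj₂ refl
IsSignUnit-* (inj₂ refl) (inj₂ refl) = inj₁ refl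

signPow-isSignUnit : ∀ k → IsSignUnit (signPow k)
signPow-isSignUnit zero          = inj₁ refl
signPow-isSignUnit (suc zero)    = inj₂ refl
signPow-isSignUnit (suc (suc k)) = signPow-isSignUnit k

1^n≡1 : ∀ n → 1ℤi ^ᵢ n ≡ 1ℤi
1^n≡1 zero    = refl
1^n≡1 (suc n) = cong (1ℤi *ᵢ_) (1^n≡1 n)

-1^n≡signPow : ∀ n → (-ᵢ 1ℤi) ^ᵢ n ≡ signPow n
-1^n≡signPow zero    = refl
-1^n≡signPow (suc n) = begin
  (-ᵢ 1ℤi) *ᵢ ((-ᵢ 1ℤi) ^ᵢ n)  ≡⟨ cong ((-ᵢ 1ℤi) *ᵢ_) (-1^n≡signPow n) ⟩
  (-ᵢ 1ℤi) *ᵢ signPow n        ≡⟨ -1*x≈-x (signPow n) ⟩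
  -ᵢ signPow n                 ≡⟨ signPow-suc n ⟨
  signPow (suc n)              ∎

signPow-pred-odd : ∀ k → suc k % 2 ≡ 1 → signPow k ≡ 1ℤi
signPow-pred-odd zero          _ = refl
signPow-pred-odd (suc zero)    ()
signPow-pred-odd (suc (suc k)) p = signPow-pred-odd k p

signPow-pred-even : ∀ k → suc k % 2 ≡ 0 → signPow k ≡ -ᵢ 1ℤi
signPow-pred-even zero          ()
signPow-pred-even (suc zero)    _ = refl
signPow-pred-even (suc (suc k)) p = signPow-pred-even k p

product-signVal : ∀ {n} (s : Fin n → Sign) → product (λ k → signVal (s k)) ≡ iℤi ^ᵢ countNeg s
product-signVal {zero}  s = refl
product-signVal {suc n} s with s zero
... | positive = trans (*-identityˡ _) (product-signVal (s ∘ suc))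
... | negative = cong (iℤi *ᵢ_) (product-signVal (s ∘ suc))

-- Determinants

signAt : ∀ {n} → Fin n → ℤi
signAt j = signPow (toℕ j)

laplaceTerm : ∀ {n} → Matrix (suc n) → Fin (suc n) → ℤi
laplaceTerm M j = (signAt j *ᵢ M zero j) *ᵢ det (minor M j)

laplaceTerm-vanish : ∀ {n} (M : Matrix (suc n)) j → M zero j ≡ 0ℤi → laplaceTerm M j ≡ 0ℤi
laplaceTerm-vanish M j M₀ⱼ≡0 = begin
  (signAt j *ᵢ M zero j) *ᵢ det (minor M j)  ≡⟨ cong (λ x → (signAt j *ᵢ x) *ᵢ det (minor M j)) M₀ⱼ≡0 ⟩
  (signAt j *ᵢ 0ℤi) *ᵢ det (minor M j)       ≡⟨ cong (_*ᵢ det (minor M j)) (zeroʳ (signAt j)) ⟩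
  0ℤi *ᵢ det (minor M j)                     ≡⟨ zeroˡ (det (minor M j)) ⟩
  0ℤi                                        ∎

det-expand : ∀ {n} (M : Matrix (suc n)) → det M ≡ sum (laplaceTerm M)
det-expand M = sumFin≡sum (laplaceTerm M)

det-cong : ∀ {n} {M N : Matrix n} → (∀ r c → M r c ≡ N r c) → det M ≡ det N
det-cong {zero}          _   = refl
det-cong {suc n} {M} {N} M≗N = begin
  det M                ≡⟨ det-expand M ⟩
  sum (laplaceTerm M)  ≡⟨ sum-cong-≗ (λ j → cong₂ (λ x D → (signAt j *ᵢ x) *ᵢ D)
                            (M≗N zero j) (det-cong (λ r c → M≗N (suc r) (punchIn j c)))) ⟩
  sum (laplaceTerm N)  ≡⟨ det-expand N ⟨
  det N                ∎

_ᵀ : ∀ {n} → Matrix n → Matrix n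
(M ᵀ) r c = M c r

-- Expanding along row 0 and then column 0, or the other way round, gives the same double sum
-- over the minors D k j; the signs agree because (-1)^(j+1) (-1)^k = (-1)^j (-1)^(k+1).
det-expandCol : ∀ {n} (M : Matrix (suc n)) →
  det M ≡ sum (λ k → (signAt k *ᵢ M k zero) *ᵢ det (minor (M ᵀ) k ᵀ))
det-expandCol {zero}  M = refl
det-expandCol {suc n} M = trans (det-expand M) (cong (laplaceTerm M zero +ᵢ_) (begin
  sum (λ j → a j *ᵢ det (minor M (suc j)))
    ≡⟨ sum-cong-≗ (λ j → cong (a j *ᵢ_) (det-expandCol (minor M (suc j)))) ⟩
  sum (λ j → a j *ᵢ sum (λ k → b k *ᵢ det (D k j)))
    ≡⟨ sum-cong-≗ (λ j → *-distribˡ-sum (a j) (λ k → b k *ᵢ det (D k j))) ⟩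
  sum (λ j → sum (λ k → a j *ᵢ (b k *ᵢ det (D k j))))
    ≡⟨ ∑-comm (λ j k → a j *ᵢ (b k *ᵢ det (D k j))) ⟩
  sum (λ k → sum (λ j → a j *ᵢ (b k *ᵢ det (D k j))))
    ≡⟨ sum-cong-≗ (λ k → sum-cong-≗ (λ j → exchange k j)) ⟩
  sum (λ k → sum (λ j → b′ k *ᵢ (a′ j *ᵢ det (D k j))))
    ≡⟨ sum-cong-≗ (λ k → trans (cong (b′ k *ᵢ_) (det-expand (minor (M ᵀ) (suc k) ᵀ)))
                               (*-distribˡ-sum (b′ k) (λ j → a′ j *ᵢ det (D k j)))) ⟨
  sum (λ k → b′ k *ᵢ det (minor (M ᵀ) (suc k) ᵀ)) ∎))
  where
  a a′ b b′ : Fin (suc n) → ℤi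
  a  j = signAt (suc j) *ᵢ M zero (suc j)
  a′ j = signAt j *ᵢ M zero (suc j)
  b  k = signAt k *ᵢ M (suc k) zero
  b′ k = signAt (suc k) *ᵢ M (suc k) zero
  D : Fin (suc n) → Fin (suc n) → Matrix n
  D k j r c = M (suc (punchIn k r)) (suc (punchIn j c))
  exchange : ∀ k j → a j *ᵢ (b k *ᵢ det (D k j)) ≡ b′ k *ᵢ (a′ j *ᵢ det (D k j))
  exchange k j
    rewrite signPow-suc (toℕ k) | signPow-suc (toℕ j)
    = negations-commute (signAt k) (signAt j) (M zero (suc j)) (M (suc k) zero) (det (D k j))
    where
    negations-commute : ∀ s t x y z →
      ((-ᵢ t) *ᵢ x) *ᵢ ((s *ᵢ y) *ᵢ z) ≡ ((-ᵢ s) *ᵢ y) *ᵢ ((t *ᵢ x) *ᵢ z)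
    negations-commute = solve-∀ ℤi-ring

det-transpose : ∀ {n} (M : Matrix n) → det (M ᵀ) ≡ det M
det-transpose {zero}  M = refl
det-transpose {suc n} M = begin
  det (M ᵀ)
    ≡⟨ det-expand (M ᵀ) ⟩
  sum (λ k → (signAt k *ᵢ M k zero) *ᵢ det (minor (M ᵀ) k))
    ≡⟨ sum-cong-≗ (λ k → cong ((signAt k *ᵢ M k zero) *ᵢ_) (det-transpose (minor (M ᵀ) k ᵀ))) ⟩
  sum (λ k → (signAt k *ᵢ M k zero) *ᵢ det (minor (M ᵀ) k ᵀ))
    ≡⟨ det-expandCol M ⟨
  det M ∎

swap₀₁ : ∀ {n} → Fin (suc (suc n)) → Fin (suc (suc n))
swap₀₁ zero          = suc zero
swap₀₁ (suc zero)    = zero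
swap₀₁ (suc (suc k)) = suc (suc k)

det-swapCols : ∀ {n} (M : Matrix (suc (suc n))) → det (λ r c → M r (swap₀₁ c)) ≡ -ᵢ det M
det-swapCols {n} M = begin
  det M′
    ≡⟨ det-expand M′ ⟩
  laplaceTerm M′ zero +ᵢ (laplaceTerm M′ (suc zero) +ᵢ sum (λ k → laplaceTerm M′ (suc (suc k))))
    ≡⟨ cong₂ _+ᵢ_ (cong ((1ℤi *ᵢ x₁) *ᵢ_) (det-cong {M = minor M′ zero} {N = minor M (suc zero)}
                                                (λ { r zero → refl ; r (suc c) → refl })))
         (cong₂ _+ᵢ_ (cong (((-ᵢ 1ℤi) *ᵢ x₀) *ᵢ_) (det-cong {M = minor M′ (suc zero)} {N = minor M zero}
                                                     (λ { r zero → refl ; r (suc c) → refl })))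
                     (sum-cong-≗ (swapped-term M))) ⟩
  ((1ℤi *ᵢ x₁) *ᵢ D₁) +ᵢ ((((-ᵢ 1ℤi) *ᵢ x₀) *ᵢ D₀) +ᵢ sum (λ k → -ᵢ rest k))
    ≡⟨ cong (λ s → ((1ℤi *ᵢ x₁) *ᵢ D₁) +ᵢ ((((-ᵢ 1ℤi) *ᵢ x₀) *ᵢ D₀) +ᵢ s)) (sum-neg rest) ⟩
  ((1ℤi *ᵢ x₁) *ᵢ D₁) +ᵢ ((((-ᵢ 1ℤi) *ᵢ x₀) *ᵢ D₀) +ᵢ (-ᵢ sum rest))
    ≡⟨ swap-first-terms x₀ x₁ D₀ D₁ (sum rest) ⟩
  -ᵢ (laplaceTerm M zero +ᵢ (laplaceTerm M (suc zero) +ᵢ sum rest))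
    ≡⟨ cong -ᵢ_ (det-expand M) ⟨
  -ᵢ det M ∎
  where
  M′ : Matrix (suc (suc n))
  M′ r c = M r (swap₀₁ c)
  x₀ x₁ D₀ D₁ : ℤi
  x₀ = M zero zero
  x₁ = M zero (suc zero)
  D₀ = det (minor M zero)
  D₁ = det (minor M (suc zero))
  rest : Fin n → ℤi
  rest k = laplaceTerm M (suc (suc k))
  swap-first-terms : ∀ x₀ x₁ D₀ D₁ S →
    ((1ℤi *ᵢ x₁) *ᵢ D₁) +ᵢ ((((-ᵢ 1ℤi) *ᵢ x₀) *ᵢ D₀) +ᵢ (-ᵢ S))
      ≡ -ᵢ (((1ℤi *ᵢ x₀) *ᵢ D₀) +ᵢ ((((-ᵢ 1ℤi) *ᵢ x₁) *ᵢ D₁) +ᵢ S))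
  swap-first-terms = solve-∀ ℤi-ring
  swapped-term : ∀ {n} (M : Matrix (suc (suc n))) (k : Fin n) →
    laplaceTerm (λ r c → M r (swap₀₁ c)) (suc (suc k)) ≡ -ᵢ laplaceTerm M (suc (suc k))
  swapped-term {suc n} M k = begin
    t *ᵢ det (λ r c → M (suc r) (swap₀₁ (punchIn (suc (suc k)) c)))
      ≡⟨ cong (t *ᵢ_) (det-cong {M = minor (λ r c → M r (swap₀₁ c)) (suc (suc k))}
                                   {N = λ r c → minor M (suc (suc k)) r (swap₀₁ c)}
                          (λ { r zero → refl ; r (suc zero) → refl ; r (suc (suc c)) → refl })) ⟩
    t *ᵢ det (λ r c → minor M (suc (suc k)) r (swap₀₁ c))
      ≡⟨ cong (t *ᵢ_) (det-swapCols (minor M (suc (suc k)))) ⟩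
    t *ᵢ (-ᵢ det (minor M (suc (suc k))))
      ≡⟨ -‿distribʳ-* t (det (minor M (suc (suc k)))) ⟨
    -ᵢ (t *ᵢ det (minor M (suc (suc k)))) ∎
    where t = signAt (suc (suc k)) *ᵢ M zero (suc (suc k))

det-swapRows : ∀ {n} (M : Matrix (suc (suc n))) → det (λ r c → M (swap₀₁ r) c) ≡ -ᵢ det M
det-swapRows M = begin
  det (λ r c → M (swap₀₁ r) c)  ≡⟨ det-transpose (λ r c → M (swap₀₁ r) c) ⟨
  det (λ r c → M (swap₀₁ c) r)  ≡⟨ det-swapCols (M ᵀ) ⟩
  -ᵢ det (M ᵀ)                  ≡⟨ cong -ᵢ_ (det-transpose M) ⟩
  -ᵢ det M                      ∎

toTop : ∀ {n} → Fin (suc n) → Fin (suc n) → Fin (suc n)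
toTop p zero    = p
toTop p (suc r) = punchIn p r

det-toTop : ∀ {n} (p : Fin (suc n)) (M : Matrix (suc n)) →
  det (λ r c → M (toTop p r) c) ≡ signAt p *ᵢ det M
det-toTop zero M =
  trans (det-cong {M = λ r c → M (toTop zero r) c} {N = M} (λ { zero c → refl ; (suc r) c → refl }))
        (sym (*-identityˡ (det M)))
det-toTop {suc n} (suc p) M = begin
  det (λ r c → M (toTop (suc p) r) c)
    ≡⟨ det-cong {M = λ r c → M (toTop (suc p) r) c} {N = λ r c → S (swap₀₁ r) c}
                (λ { zero c → refl ; (suc zero) c → refl ; (suc (suc r)) c → refl }) ⟩
  det (λ r c → S (swap₀₁ r) c)
    ≡⟨ det-swapRows S ⟩
  -ᵢ det S
    ≡⟨ cong -ᵢ_ (det-expand S) ⟩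
  -ᵢ sum (laplaceTerm S)
    ≡⟨ cong -ᵢ_ (sum-cong-≗ (λ j → cong ((signAt j *ᵢ M zero j) *ᵢ_) (det-toTop p (minor M j)))) ⟩
  -ᵢ sum (λ j → (signAt j *ᵢ M zero j) *ᵢ (signAt p *ᵢ det (minor M j)))
    ≡⟨ cong -ᵢ_ (sum-cong-≗ (λ j → pull-left (signAt j *ᵢ M zero j) (signAt p) (det (minor M j)))) ⟩
  -ᵢ sum (λ j → signAt p *ᵢ laplaceTerm M j)
    ≡⟨ cong -ᵢ_ (*-distribˡ-sum (signAt p) (laplaceTerm M)) ⟨
  -ᵢ (signAt p *ᵢ sum (laplaceTerm M))
    ≡⟨ -‿distribˡ-* (signAt p) (sum (laplaceTerm M)) ⟩
  (-ᵢ signAt p) *ᵢ sum (laplaceTerm M)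
    ≡⟨ cong₂ _*ᵢ_ (signPow-suc (toℕ p)) (det-expand M) ⟨
  signAt (suc p) *ᵢ det M ∎
  where
  S : Matrix (suc (suc n))
  S zero    c = M zero c
  S (suc r) c = M (suc (toTop p r)) c
  pull-left : ∀ x y z → x *ᵢ (y *ᵢ z) ≡ y *ᵢ (x *ᵢ z)
  pull-left = solve-∀ ℤi-ring

sign : ∀ {n} → Permutation′ n → ℤi
sign {zero}  π = 1ℤi
sign {suc n} π = signAt (π ⟨$⟩ʳ zero) *ᵢ sign (remove zero π)

sign-isSignUnit : ∀ {n} (π : Permutation′ n) → IsSignUnit (sign π)
sign-isSignUnit {zero}  π = inj₁ refl
sign-isSignUnit {suc n} π =
  IsSignUnit-* (signPow-isSignUnit (toℕ (π ⟨$⟩ʳ zero))) (sign-isSignUnit (remove zero π))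

det-permuteRows : ∀ {n} (π : Permutation′ n) (M : Matrix n) →
  det (λ r c → M (π ⟨$⟩ʳ r) c) ≡ sign π *ᵢ det M
det-permuteRows {zero}  π M = refl
det-permuteRows {suc n} π M = begin
  det (λ r c → M (π ⟨$⟩ʳ r) c)
    ≡⟨ det-expand (λ r c → M (π ⟨$⟩ʳ r) c) ⟩
  sum (λ j → (signAt j *ᵢ M p j) *ᵢ det (λ r c → M (π ⟨$⟩ʳ suc r) (punchIn j c)))
    ≡⟨ sum-cong-≗ (λ j → cong ((signAt j *ᵢ M p j) *ᵢ_) (removed-rows j)) ⟩
  sum (λ j → (signAt j *ᵢ M p j) *ᵢ (sign π′ *ᵢ det (minor M′ j)))
    ≡⟨ sum-cong-≗ (λ j → pull-left (signAt j *ᵢ M p j) (sign π′) (det (minor M′ j))) ⟩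
  sum (λ j → sign π′ *ᵢ laplaceTerm M′ j)
    ≡⟨ *-distribˡ-sum (sign π′) (laplaceTerm M′) ⟨
  sign π′ *ᵢ sum (laplaceTerm M′)
    ≡⟨ cong (sign π′ *ᵢ_) (trans (sym (det-expand M′)) (det-toTop p M)) ⟩
  sign π′ *ᵢ (signAt p *ᵢ det M)
    ≡⟨ reassociate (sign π′) (signAt p) (det M) ⟩
  (signAt p *ᵢ sign π′) *ᵢ det M ∎
  where
  p : Fin (suc n)
  p = π ⟨$⟩ʳ zero
  π′ : Permutation′ n
  π′ = remove zero π
  M′ : Matrix (suc n)
  M′ r c = M (toTop p r) c
  removed-rows : ∀ j → det (λ r c → M (π ⟨$⟩ʳ suc r) (punchIn j c)) ≡ sign π′ *ᵢ det (minor M′ j)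
  removed-rows j = trans
    (det-cong {M = λ r c → M (π ⟨$⟩ʳ suc r) (punchIn j c)}
              {N = λ r c → M (punchIn p (π′ ⟨$⟩ʳ r)) (punchIn j c)}
              (λ r c → cong (λ q → M q (punchIn j c)) (punchIn-permute π zero r)))
    (det-permuteRows π′ (λ r c → M (punchIn p r) (punchIn j c)))
  pull-left : ∀ x y z → x *ᵢ (y *ᵢ z) ≡ y *ᵢ (x *ᵢ z)
  pull-left = solve-∀ ℤi-ring
  reassociate : ∀ x y z → x *ᵢ (y *ᵢ z) ≡ (y *ᵢ x) *ᵢ z
  reassociate = solve-∀ ℤi-ring

det-permuteCols : ∀ {n} (π : Permutation′ n) (M : Matrix n) →
  det (λ r c → M r (π ⟨$⟩ʳ c)) ≡ sign π *ᵢ det M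
det-permuteCols π M = begin
  det (λ r c → M r (π ⟨$⟩ʳ c))  ≡⟨ det-transpose (λ r c → M r (π ⟨$⟩ʳ c)) ⟨
  det (λ r c → M c (π ⟨$⟩ʳ r))  ≡⟨ det-permuteRows π (M ᵀ) ⟩
  sign π *ᵢ det (M ᵀ)           ≡⟨ cong (sign π *ᵢ_) (det-transpose M) ⟩
  sign π *ᵢ det M               ∎

det-scaleRows : ∀ {n} (d : Fin n → ℤi) (M : Matrix n) →
  det (λ r c → d r *ᵢ M r c) ≡ product d *ᵢ det M
det-scaleRows {zero}  d M = refl
det-scaleRows {suc n} d M = begin
  det (λ r c → d r *ᵢ M r c)
    ≡⟨ det-expand (λ r c → d r *ᵢ M r c) ⟩
  sum (λ j → (signAt j *ᵢ (d zero *ᵢ M zero j)) *ᵢ det (λ r c → d (suc r) *ᵢ minor M j r c))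
    ≡⟨ sum-cong-≗ (λ j → cong ((signAt j *ᵢ (d zero *ᵢ M zero j)) *ᵢ_)
                              (det-scaleRows (λ r → d (suc r)) (minor M j))) ⟩
  sum (λ j → (signAt j *ᵢ (d zero *ᵢ M zero j)) *ᵢ (product (λ r → d (suc r)) *ᵢ det (minor M j)))
    ≡⟨ sum-cong-≗ (λ j → factor-out (signAt j) (d zero) (M zero j) (product (λ r → d (suc r))) (det (minor M j))) ⟩
  sum (λ j → product d *ᵢ laplaceTerm M j)
    ≡⟨ *-distribˡ-sum (product d) (laplaceTerm M) ⟨
  product d *ᵢ sum (laplaceTerm M)
    ≡⟨ cong (product d *ᵢ_) (det-expand M) ⟨
  product d *ᵢ det M ∎
  where
  factor-out : ∀ s x y p D → (s *ᵢ (x *ᵢ y)) *ᵢ (p *ᵢ D) ≡ (x *ᵢ p) *ᵢ ((s *ᵢ y) *ᵢ D)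
  factor-out = solve-∀ ℤi-ring

det-scaleCols : ∀ {n} (d : Fin n → ℤi) (M : Matrix n) →
  det (λ r c → M r c *ᵢ d c) ≡ product d *ᵢ det M
det-scaleCols d M = begin
  det (λ r c → M r c *ᵢ d c)   ≡⟨ det-transpose (λ r c → M r c *ᵢ d c) ⟨
  det (λ r c → M c r *ᵢ d r)   ≡⟨ det-cong {M = λ r c → M c r *ᵢ d r} {N = λ r c → d r *ᵢ M c r}
                                    (λ r c → *ᵢ-comm (M c r) (d r)) ⟩
  det (λ r c → d r *ᵢ M c r)   ≡⟨ det-scaleRows d (M ᵀ) ⟩
  product d *ᵢ det (M ᵀ)       ≡⟨ cong (product d *ᵢ_) (det-transpose M) ⟩
  product d *ᵢ det M           ∎

det-lowerTriangular : ∀ {n} (M : Matrix n) → (∀ {r c} → r < c → M r c ≡ 0ℤi) →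
  det M ≡ product (λ k → M k k)
det-lowerTriangular {zero}  M lower = refl
det-lowerTriangular {suc n} M lower = begin
  det M
    ≡⟨ det-expand M ⟩
  laplaceTerm M zero +ᵢ sum (λ j → laplaceTerm M (suc j))
    ≡⟨ cong (laplaceTerm M zero +ᵢ_)
            (sum-zero (λ j → laplaceTerm-vanish M (suc j) (lower {zero} {suc j} ℕ.z<s))) ⟩
  ((1ℤi *ᵢ M zero zero) *ᵢ det (minor M zero)) +ᵢ 0ℤi
    ≡⟨ cong (λ D → ((1ℤi *ᵢ M zero zero) *ᵢ D) +ᵢ 0ℤi)
            (det-lowerTriangular (minor M zero) (λ r<c → lower (ℕ.s<s r<c))) ⟩
  ((1ℤi *ᵢ M zero zero) *ᵢ product (λ k → M (suc k) (suc k))) +ᵢ 0ℤi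
    ≡⟨ simplify (M zero zero) (product (λ k → M (suc k) (suc k))) ⟩
  product (λ k → M k k) ∎
  where
  simplify : ∀ x P → ((1ℤi *ᵢ x) *ᵢ P) +ᵢ 0ℤi ≡ x *ᵢ P
  simplify = solve-∀ ℤi-ring

det-upperTriangular : ∀ {n} (M : Matrix n) → (∀ {r c} → c < r → M r c ≡ 0ℤi) →
  det M ≡ product (λ k → M k k)
det-upperTriangular M upper = trans (sym (det-transpose M)) (det-lowerTriangular (M ᵀ) upper)

det-permuteScaled : ∀ {n} (M : Matrix n) (π σ : Permutation′ n) (d : Fin n → ℤi) →
  det (λ v ℓ → M (π ⟨$⟩ˡ v) (σ ⟨$⟩ʳ ℓ) *ᵢ d ℓ)
    ≡ (product d *ᵢ (sign (flip π) *ᵢ sign σ)) *ᵢ det M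
det-permuteScaled M π σ d = begin
  det (λ v ℓ → M (π ⟨$⟩ˡ v) (σ ⟨$⟩ʳ ℓ) *ᵢ d ℓ)
    ≡⟨ det-scaleCols d (λ v ℓ → M (π ⟨$⟩ˡ v) (σ ⟨$⟩ʳ ℓ)) ⟩
  product d *ᵢ det (λ v ℓ → M (flip π ⟨$⟩ʳ v) (σ ⟨$⟩ʳ ℓ))
    ≡⟨ cong (product d *ᵢ_) (det-permuteRows (flip π) (λ r ℓ → M r (σ ⟨$⟩ʳ ℓ))) ⟩
  product d *ᵢ (sign (flip π) *ᵢ det (λ r ℓ → M r (σ ⟨$⟩ʳ ℓ)))
    ≡⟨ cong (λ x → product d *ᵢ (sign (flip π) *ᵢ x)) (det-permuteCols σ M) ⟩
  product d *ᵢ (sign (flip π) *ᵢ (sign σ *ᵢ det M))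
    ≡⟨ reassociate (product d) (sign (flip π)) (sign σ) (det M) ⟩
  (product d *ᵢ (sign (flip π) *ᵢ sign σ)) *ᵢ det M ∎
  where
  reassociate : ∀ p x y D → p *ᵢ (x *ᵢ (y *ᵢ D)) ≡ (p *ᵢ (x *ᵢ y)) *ᵢ D
  reassociate = solve-∀ ℤi-ring

-- The cycle matrix

toℕ-next : ∀ {n} (k : Fin (suc n)) → toℕ (next k) ≡ suc (toℕ k) % suc n
toℕ-next {n} k = toℕ-fromℕ< (m%n<n (suc (toℕ k)) (suc n))

next-inject₁ : ∀ {n} (k : Fin n) → next (inject₁ k) ≡ suc k
next-inject₁ {n} k = toℕ-injective (begin
  toℕ (next (inject₁ k))          ≡⟨ toℕ-next (inject₁ k) ⟩
  suc (toℕ (inject₁ k)) % suc n   ≡⟨ cong (λ t → suc t % suc n) (toℕ-inject₁ k) ⟩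
  suc (toℕ k) % suc n             ≡⟨ m<n⇒m%n≡m (ℕ.s<s (toℕ<n k)) ⟩
  suc (toℕ k)                     ∎)

next-fromℕ : ∀ n → next (fromℕ n) ≡ zero
next-fromℕ n = toℕ-injective (begin
  toℕ (next (fromℕ n))          ≡⟨ toℕ-next (fromℕ n) ⟩
  suc (toℕ (fromℕ n)) % suc n   ≡⟨ cong (λ t → suc t % suc n) (toℕ-fromℕ n) ⟩
  suc n % suc n                 ≡⟨ n%n≡0 (suc n) ⟩
  0                             ∎)

data LastView : ∀ {n} → Fin (suc n) → Set where
  last   : ∀ {n} → LastView (fromℕ n)
  inject : ∀ {n} (k : Fin n) → LastView (inject₁ k)

lastView : ∀ {n} (k : Fin (suc n)) → LastView k
lastView {zero}  zero    = last
lastView {suc n} zero    = inject zero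
lastView {suc n} (suc k) with lastView k
... | last     = last
... | inject j = inject (suc j)

punchIn-fromℕ : ∀ {n} (c : Fin n) → punchIn (fromℕ n) c ≡ inject₁ c
punchIn-fromℕ zero    = refl
punchIn-fromℕ (suc c) = cong suc (punchIn-fromℕ c)

cycleMatrix : ∀ {n} → ℤi → ℤi → Matrix n
cycleMatrix a b u k = if does (u ≟ k) then a else if does (u ≟ next k) then b else 0ℤi

cycleMatrix-diag : ∀ {n} a b (k : Fin n) → cycleMatrix a b k k ≡ a
cycleMatrix-diag a b k rewrite dec-true (k ≟ k) refl = refl

cycleMatrix-next : ∀ {n} a b {u k : Fin n} → u ≢ k → u ≡ next k → cycleMatrix a b u k ≡ b
cycleMatrix-next a b {u} {k} u≢k u≡k⁺ rewrite dec-false (u ≟ k) u≢k | dec-true (u ≟ next k) u≡k⁺ = refl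

cycleMatrix-off : ∀ {n} a b {u k : Fin n} → u ≢ k → u ≢ next k → cycleMatrix a b u k ≡ 0ℤi
cycleMatrix-off a b {u} {k} u≢k u≢k⁺ rewrite dec-false (u ≟ k) u≢k | dec-false (u ≟ next k) u≢k⁺ = refl

module _ {m : ℕ} (a b : ℤi) where

  private
    C : Matrix (suc (suc m))
    C = cycleMatrix a b

  cycleMatrix-minor₀-lower : ∀ {r c} → r < c → minor C zero r c ≡ 0ℤi
  cycleMatrix-minor₀-lower {r} {c} r<c = cycleMatrix-off a b (<⇒≢ r<c ∘ suc-injective) (not-next (lastView c) r<c)
    where
    not-next : ∀ {c} → LastView c → r < c → suc r ≢ next (suc c)
    not-next last        _   eq = 0≢1+n (sym (trans eq (next-fromℕ (suc m))))
    not-next (inject c′) r<c eq = ℕ.<-asym (ℕ.n<1+n (toℕ c′))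
      (subst₂ ℕ._<_ (cong toℕ (suc-injective (trans eq (next-inject₁ (suc c′))))) (toℕ-inject₁ c′) r<c)

  cycleMatrix-minorLast-upper : ∀ {r c} → c < r → minor C (fromℕ (suc m)) r c ≡ 0ℤi
  cycleMatrix-minorLast-upper {r} {c} c<r = trans (cong (C (suc r)) (punchIn-fromℕ c)) (cycleMatrix-off a b
    (λ eq → ℕ.<-asym c<r (subst (toℕ r ℕ.<_) (trans (cong toℕ eq) (toℕ-inject₁ c)) (ℕ.n<1+n (toℕ r))))
    (λ eq → <⇒≢ c<r (sym (suc-injective (trans eq (next-inject₁ c))))))

  cycleMatrix-minorLast-diag : ∀ k → minor C (fromℕ (suc m)) k k ≡ b
  cycleMatrix-minorLast-diag k = trans (cong (C (suc k)) (punchIn-fromℕ k)) (cycleMatrix-next a b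
    (λ eq → ℕ.1+n≢n (trans (cong toℕ eq) (toℕ-inject₁ k)))
    (sym (next-inject₁ k)))

  det-cycleMatrix : det C ≡ (a ^ᵢ suc (suc m)) +ᵢ (signPow (suc m) *ᵢ (b ^ᵢ suc (suc m)))
  det-cycleMatrix = begin
    det C
      ≡⟨ det-expand C ⟩
    laplaceTerm C zero +ᵢ sum (λ j → laplaceTerm C (suc j))
      ≡⟨ cong (laplaceTerm C zero +ᵢ_) (sum-init-last (λ j → laplaceTerm C (suc j))) ⟩
    laplaceTerm C zero +ᵢ (sum (λ j → laplaceTerm C (suc (inject₁ j))) +ᵢ laplaceTerm C (fromℕ (suc m)))
      ≡⟨ cong₂ _+ᵢ_ first-term (cong₂ _+ᵢ_ (sum-zero middle-term) last-term) ⟩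
    ((1ℤi *ᵢ a) *ᵢ (a ^ᵢ suc m)) +ᵢ (0ℤi +ᵢ ((signPow (suc m) *ᵢ b) *ᵢ (b ^ᵢ suc m)))
      ≡⟨ simplify a b (a ^ᵢ suc m) (b ^ᵢ suc m) (signPow (suc m)) ⟩
    (a ^ᵢ suc (suc m)) +ᵢ (signPow (suc m) *ᵢ (b ^ᵢ suc (suc m))) ∎
    where
    first-term : laplaceTerm C zero ≡ (1ℤi *ᵢ a) *ᵢ (a ^ᵢ suc m)
    first-term = cong₂ (λ x D → (1ℤi *ᵢ x) *ᵢ D) (cycleMatrix-diag {suc (suc m)} a b zero)
      (trans (det-lowerTriangular (minor C zero) cycleMatrix-minor₀-lower)
             (product-const {suc m} (λ k → cycleMatrix-diag a b (suc k))))
    middle-term : ∀ j → laplaceTerm C (suc (inject₁ j)) ≡ 0ℤi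
    middle-term j = laplaceTerm-vanish C (suc (inject₁ j))
      (cycleMatrix-off a b 0≢1+n (λ eq → 0≢1+n (trans eq (next-inject₁ (suc j)))))
    last-term : laplaceTerm C (fromℕ (suc m)) ≡ (signPow (suc m) *ᵢ b) *ᵢ (b ^ᵢ suc m)
    last-term = cong₂ _*ᵢ_
      (cong₂ _*ᵢ_ (cong signPow (toℕ-fromℕ (suc m))) (cycleMatrix-next a b 0≢1+n (sym (next-fromℕ (suc m)))))
      (trans (det-upperTriangular (minor C (fromℕ (suc m))) cycleMatrix-minorLast-upper)
             (product-const {suc m} cycleMatrix-minorLast-diag))
    simplify : ∀ a b A B s →
      ((1ℤi *ᵢ a) *ᵢ A) +ᵢ (0ℤi +ᵢ ((s *ᵢ b) *ᵢ B)) ≡ (a *ᵢ A) +ᵢ (s *ᵢ (b *ᵢ B))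
    simplify = solve-∀ ℤi-ring

-- Incidence matrices of a signed cycle

does-≟-inverse : ∀ {n} (π : Permutation′ n) v k → does (v ≟ π ⟨$⟩ʳ k) ≡ does (π ⟨$⟩ˡ v ≟ k)
does-≟-inverse π v k = does-⇔ (mk⇔ (Inverse.inverseʳ π) (λ eq → sym (Inverse.inverseˡ π (sym eq))))
                               (v ≟ π ⟨$⟩ʳ k) (π ⟨$⟩ˡ v ≟ k)

netInc-cycleMatrix : ∀ {n} (π σ : Permutation′ n) s v ℓ →
  netInc π σ s v ℓ ≡ cycleMatrix 1ℤi 1ℤi (π ⟨$⟩ˡ v) (σ ⟨$⟩ʳ ℓ) *ᵢ signVal (s (σ ⟨$⟩ʳ ℓ))
netInc-cycleMatrix π σ s v ℓ
  rewrite does-≟-inverse π v (σ ⟨$⟩ʳ ℓ) | does-≟-inverse π v (next (σ ⟨$⟩ʳ ℓ))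
  with does (π ⟨$⟩ˡ v ≟ σ ⟨$⟩ʳ ℓ) | does (π ⟨$⟩ˡ v ≟ next (σ ⟨$⟩ʳ ℓ)) | signVal (s (σ ⟨$⟩ʳ ℓ))
... | true  | _     | c = sym (*-identityˡ c)
... | false | true  | c = sym (*-identityˡ c)
... | false | false | c = sym (zeroˡ c)

orientation : Bool → ℤi
orientation true  = -ᵢ 1ℤi
orientation false = 1ℤi

orientedNetInc-cycleMatrix : ∀ {n} (π σ : Permutation′ n) s o v ℓ →
  orientedNetInc π σ s o v ℓ
    ≡ cycleMatrix 1ℤi (-ᵢ 1ℤi) (π ⟨$⟩ˡ v) (σ ⟨$⟩ʳ ℓ) *ᵢ (orientation (o ℓ) *ᵢ signVal (s (σ ⟨$⟩ʳ ℓ)))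
orientedNetInc-cycleMatrix π σ s o v ℓ
  rewrite does-≟-inverse π v (σ ⟨$⟩ʳ ℓ) | does-≟-inverse π v (next (σ ⟨$⟩ʳ ℓ))
  with does (π ⟨$⟩ˡ v ≟ σ ⟨$⟩ʳ ℓ) | does (π ⟨$⟩ˡ v ≟ next (σ ⟨$⟩ʳ ℓ))
     | o ℓ | signVal (s (σ ⟨$⟩ʳ ℓ))
... | true  | _     | true  | c = sym (trans (*-identityˡ _) (-1*x≈-x c))
... | true  | _     | false | c = sym (trans (*-identityˡ _) (*-identityˡ c))
... | false | true  | true  | c = sym (trans (-1*x≈-x _) (trans (cong -ᵢ_ (-1*x≈-x c)) (-‿involutive c)))
... | false | true  | false | c = sym (trans (-1*x≈-x _) (cong -ᵢ_ (*-identityˡ c)))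
... | false | false | b     | c = sym (zeroˡ (orientation b *ᵢ c))

det-netInc : ∀ {m} (π σ : Permutation′ (suc (suc m))) s →
  det (netInc π σ s) ≡ ((iℤi ^ᵢ countNeg s) *ᵢ (sign (flip π) *ᵢ sign σ)) *ᵢ (1ℤi +ᵢ signPow (suc m))
det-netInc {m} π σ s = begin
  det (netInc π σ s)
    ≡⟨ det-cong {M = netInc π σ s}
                {N = λ v ℓ → C (π ⟨$⟩ˡ v) (σ ⟨$⟩ʳ ℓ) *ᵢ signVal (s (σ ⟨$⟩ʳ ℓ))}
                (netInc-cycleMatrix π σ s) ⟩
  det (λ v ℓ → C (π ⟨$⟩ˡ v) (σ ⟨$⟩ʳ ℓ) *ᵢ signVal (s (σ ⟨$⟩ʳ ℓ)))
    ≡⟨ det-permuteScaled C π σ (λ ℓ → signVal (s (σ ⟨$⟩ʳ ℓ))) ⟩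
  (product (λ ℓ → signVal (s (σ ⟨$⟩ʳ ℓ))) *ᵢ ε) *ᵢ det C
    ≡⟨ cong₂ (λ P D → (P *ᵢ ε) *ᵢ D)
             (trans (sym (product-permute (λ k → signVal (s k)) σ)) (product-signVal s))
             (det-cycleMatrix {m} 1ℤi 1ℤi) ⟩
  ((iℤi ^ᵢ countNeg s) *ᵢ ε) *ᵢ ((1ℤi ^ᵢ suc (suc m)) +ᵢ (signPow (suc m) *ᵢ (1ℤi ^ᵢ suc (suc m))))
    ≡⟨ cong (λ x → ((iℤi ^ᵢ countNeg s) *ᵢ ε) *ᵢ (x +ᵢ (signPow (suc m) *ᵢ x))) (1^n≡1 (suc (suc m))) ⟩
  ((iℤi ^ᵢ countNeg s) *ᵢ ε) *ᵢ (1ℤi +ᵢ (signPow (suc m) *ᵢ 1ℤi))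
    ≡⟨ cong (λ x → ((iℤi ^ᵢ countNeg s) *ᵢ ε) *ᵢ (1ℤi +ᵢ x)) (*-identityʳ (signPow (suc m))) ⟩
  ((iℤi ^ᵢ countNeg s) *ᵢ ε) *ᵢ (1ℤi +ᵢ signPow (suc m)) ∎
  where
  C : Matrix (suc (suc m))
  C = cycleMatrix 1ℤi 1ℤi
  ε : ℤi
  ε = sign (flip π) *ᵢ sign σ

det-orientedNetInc : ∀ {m} (π σ : Permutation′ (suc (suc m))) s o → det (orientedNetInc π σ s o) ≡ 0ℤi
det-orientedNetInc {m} π σ s o = begin
  det (orientedNetInc π σ s o)
    ≡⟨ det-cong {M = orientedNetInc π σ s o} {N = λ v ℓ → C (π ⟨$⟩ˡ v) (σ ⟨$⟩ʳ ℓ) *ᵢ d ℓ}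
                (orientedNetInc-cycleMatrix π σ s o) ⟩
  det (λ v ℓ → C (π ⟨$⟩ˡ v) (σ ⟨$⟩ʳ ℓ) *ᵢ d ℓ)
    ≡⟨ det-permuteScaled C π σ d ⟩
  κ *ᵢ det C
    ≡⟨ cong (κ *ᵢ_) (trans (det-cycleMatrix {m} 1ℤi (-ᵢ 1ℤi)) alternating-sum) ⟩
  κ *ᵢ 0ℤi
    ≡⟨ zeroʳ κ ⟩
  0ℤi ∎
  where
  C : Matrix (suc (suc m))
  C = cycleMatrix 1ℤi (-ᵢ 1ℤi)
  d : Fin (suc (suc m)) → ℤi
  d ℓ = orientation (o ℓ) *ᵢ signVal (s (σ ⟨$⟩ʳ ℓ))
  κ : ℤi
  κ = product d *ᵢ (sign (flip π) *ᵢ sign σ)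
  alternating-sum : (1ℤi ^ᵢ suc (suc m)) +ᵢ (signPow (suc m) *ᵢ ((-ᵢ 1ℤi) ^ᵢ suc (suc m))) ≡ 0ℤi
  alternating-sum = begin
    (1ℤi ^ᵢ suc (suc m)) +ᵢ (signPow (suc m) *ᵢ ((-ᵢ 1ℤi) ^ᵢ suc (suc m)))
      ≡⟨ cong₂ (λ x y → x +ᵢ (signPow (suc m) *ᵢ y)) (1^n≡1 (suc (suc m))) (-1^n≡signPow (suc (suc m))) ⟩
    1ℤi +ᵢ (signPow (suc m) *ᵢ signPow m)
      ≡⟨ cong (λ x → 1ℤi +ᵢ (x *ᵢ signPow m)) (signPow-suc m) ⟩
    1ℤi +ᵢ ((-ᵢ signPow m) *ᵢ signPow m)
      ≡⟨ cancel (signPow-isSignUnit m) ⟩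
    0ℤi ∎
    where
    cancel : ∀ {x} → IsSignUnit x → 1ℤi +ᵢ ((-ᵢ x) *ᵢ x) ≡ 0ℤi
    cancel (inj₁ refl) = refl
    cancel (inj₂ refl) = refl

scaled-by-sign : ∀ {ε} x → IsSignUnit ε →
    ((x *ᵢ ε) *ᵢ (1ℤi +ᵢ 1ℤi) ≡ (1ℤi +ᵢ 1ℤi) *ᵢ x)
  ⊎ ((x *ᵢ ε) *ᵢ (1ℤi +ᵢ 1ℤi) ≡ -ᵢ ((1ℤi +ᵢ 1ℤi) *ᵢ x))
scaled-by-sign x (inj₁ refl) = inj₁ (by-plus x)
  where
  by-plus : ∀ x → (x *ᵢ 1ℤi) *ᵢ (1ℤi +ᵢ 1ℤi) ≡ (1ℤi +ᵢ 1ℤi) *ᵢ x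
  by-plus = solve-∀ ℤi-ring
scaled-by-sign x (inj₂ refl) = inj₂ (by-minus x)
  where
  by-minus : ∀ x → (x *ᵢ (-ᵢ 1ℤi)) *ᵢ (1ℤi +ᵢ 1ℤi) ≡ -ᵢ ((1ℤi +ᵢ 1ℤi) *ᵢ x)
  by-minus = solve-∀ ℤi-ring

mainTheorem7 : (n : ℕ) → 3 ≤ n → (π σ : Permutation′ n) → (s : Fin n → Sign) →
    ((o : Fin n → Bool) → det (orientedNetInc π σ s o) ≡ 0ℤi)
  × (n % 2 ≡ 1 → (det (netInc π σ s) ≡ (1ℤi +ᵢ 1ℤi) *ᵢ (iℤi ^ᵢ countNeg s))
                 ⊎ (det (netInc π σ s) ≡ -ᵢ ((1ℤi +ᵢ 1ℤi) *ᵢ (iℤi ^ᵢ countNeg s))))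
  × (n % 2 ≡ 0 → det (netInc π σ s) ≡ 0ℤi)
mainTheorem7 (suc zero)          (s≤s ())
mainTheorem7 (suc (suc zero))    (s≤s (s≤s ()))
mainTheorem7 (suc (suc (suc k))) _ π σ s =
    det-orientedNetInc π σ s
  , (λ odd → Sum.map (trans (netDet (signPow-pred-odd (suc (suc k)) odd)))
                     (trans (netDet (signPow-pred-odd (suc (suc k)) odd)))
                     (scaled-by-sign x (IsSignUnit-* (sign-isSignUnit (flip π)) (sign-isSignUnit σ))))
  , (λ even → trans (netDet (signPow-pred-even (suc (suc k)) even)) (zeroʳ (x *ᵢ ε)))
  where
  x ε : ℤi
  x = iℤi ^ᵢ countNeg s
  ε = sign (flip π) *ᵢ sign σ
  netDet : ∀ {t} → signPow (suc (suc k)) ≡ t → det (netInc π σ s) ≡ (x *ᵢ ε) *ᵢ (1ℤi +ᵢ t)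
  netDet refl = det-netInc π σ s
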